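{- Let $R$ be a monotone transit function on a non-empty finite set $V$ satisfying (tb): for every $W\subseteq V$ with $|W|\ge3$ there exists $x\in W$ such that for all $u,v\in W$, $R(x,u)\subseteq R(x,v)$ or $R(x,v)\subseteq R(x,u)$. Then $R$ satisfies (w): for all $x,y,z\in V$, $z\in R(x,y)$ or $y\in R(x,z)$ or $x\in R(y,z)$.
   Context: A transit function on $V$ is a map $R:V\times V\to 2^V$ with $u\in R(u,v)$, $R(u,v)=R(v,u)$, $R(u,u)=\{u\}$ for all $u,v\in V$; it is monotone if $p,q\in R(u,v)$ implies $R(p,q)\subseteq R(u,v)$. -}

module Defs where

open import Data.Nat using (ℕ; suc; _≤_)
open import Data.Fin using (Fin)
open import Data.Fin.Subset using (Subset; _∈_; _⊆_; ⁅_⁆; ∣_∣)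
open import Data.Sum using (_⊎_)
open import Data.Product using (_×_; ∃-syntax)
open import Relation.Binary.PropositionalEquality using (_≡_)

TransitFn : ℕ → Set
TransitFn n = Fin n → Fin n → Subset n

record IsTransit {n : ℕ} (R : TransitFn n) : Set where
  field
    extensive : ∀ u v → u ∈ R u v
    symmetric : ∀ u v → R u v ≡ R v u
    idempotent : ∀ u → R u u ≡ ⁅ u ⁆

Monotone : {n : ℕ} → TransitFn n → Set
Monotone {n} R = ∀ u v p q → p ∈ R u v → q ∈ R u v → R p q ⊆ R u v

AxiomTB : {n : ℕ} → TransitFn n → Set
AxiomTB {n} R = (W : Subset n) → 3 ≤ ∣ W ∣ →
  ∃[ x ] (x ∈ W × (∀ u v → u ∈ W → v ∈ W → (R x u ⊆ R x v) ⊎ (R x v ⊆ R x u)))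

AxiomW : {n : ℕ} → TransitFn n → Set
AxiomW {n} R = ∀ x y z → z ∈ R x y ⊎ (y ∈ R x z ⊎ x ∈ R y z)

{-# OPTIONS --safe #-}
-- Apply (tb) to W = {x, y, z} (when the three points are distinct) and let w be the
-- centre it provides. The intervals from w to the other two points are nested, and
-- each interval contains its endpoint, so one of these two points lies in the interval
-- from w to the other; by symmetry of R this is one of the three disjuncts of (w).
module Submission where

open import Defs
open import Data.Nat using (ℕ; suc; _≤_; _<_)
open import Data.Nat.Properties using (≤-<-trans; ≤-reflexive)
open import Data.Fin using (Fin; _≟_)
open import Data.Fin.Subset using (Subset; _∈_; _∉_; _⊆_; ⁅_⁆; ∣_∣; _∪_)
open import Data.Fin.Subset.Properties
  using (p⊂q⇒∣p∣<∣q∣; x∈p∪q⁻; p⊆p∪q; q⊆p∪q; x∈⁅x⁆; x∈⁅y⁆⇒x≡y; x≢y⇒x∉⁅y⁆; ∣⁅x⁆∣≡1)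
open import Data.Sum using (_⊎_; inj₁; inj₂; [_,_])
open import Data.Product using (_,_)
open import Relation.Binary.PropositionalEquality using (_≡_; _≢_; refl; sym; subst)
open import Relation.Nullary using (yes; no)

private
  variable
    n : ℕ

∣p∣<∣p∪⁅x⁆∣ : {p : Subset n} {x : Fin n} → x ∉ p → ∣ p ∣ < ∣ p ∪ ⁅ x ⁆ ∣
∣p∣<∣p∪⁅x⁆∣ {x = x} x∉p = p⊂q⇒∣p∣<∣q∣ (p⊆p∪q ⁅ x ⁆ , x , q⊆p∪q _ ⁅ x ⁆ (x∈⁅x⁆ x) , x∉p)

triple : Fin n → Fin n → Fin n → Subset n
triple x y z = (⁅ x ⁆ ∪ ⁅ y ⁆) ∪ ⁅ z ⁆

module _ {x y z : Fin n} where

  x∈triple : x ∈ triple x y z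
  x∈triple = p⊆p∪q ⁅ z ⁆ (p⊆p∪q ⁅ y ⁆ (x∈⁅x⁆ x))

  y∈triple : y ∈ triple x y z
  y∈triple = p⊆p∪q ⁅ z ⁆ (q⊆p∪q ⁅ x ⁆ ⁅ y ⁆ (x∈⁅x⁆ y))

  z∈triple : z ∈ triple x y z
  z∈triple = q⊆p∪q (⁅ x ⁆ ∪ ⁅ y ⁆) ⁅ z ⁆ (x∈⁅x⁆ z)

  ∈triple⁻ : ∀ {w} → w ∈ triple x y z → w ≡ x ⊎ w ≡ y ⊎ w ≡ z
  ∈triple⁻ w∈ with x∈p∪q⁻ (⁅ x ⁆ ∪ ⁅ y ⁆) ⁅ z ⁆ w∈
  ... | inj₂ w∈z = inj₂ (inj₂ (x∈⁅y⁆⇒x≡y z w∈z))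
  ... | inj₁ w∈xy with x∈p∪q⁻ ⁅ x ⁆ ⁅ y ⁆ w∈xy
  ...   | inj₁ w∈x = inj₁ (x∈⁅y⁆⇒x≡y x w∈x)
  ...   | inj₂ w∈y = inj₂ (inj₁ (x∈⁅y⁆⇒x≡y y w∈y))

  3≤∣triple∣ : y ≢ x → z ≢ x → z ≢ y → 3 ≤ ∣ triple x y z ∣
  3≤∣triple∣ y≢x z≢x z≢y = ≤-<-trans 2≤∣⁅x,y⁆∣ (∣p∣<∣p∪⁅x⁆∣ z∉⁅x,y⁆)
    where
    2≤∣⁅x,y⁆∣ : 2 ≤ ∣ ⁅ x ⁆ ∪ ⁅ y ⁆ ∣
    2≤∣⁅x,y⁆∣ = ≤-<-trans (≤-reflexive (sym (∣⁅x⁆∣≡1 x))) (∣p∣<∣p∪⁅x⁆∣ (x≢y⇒x∉⁅y⁆ y≢x))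

    z∉⁅x,y⁆ : z ∉ ⁅ x ⁆ ∪ ⁅ y ⁆
    z∉⁅x,y⁆ z∈ = [ x≢y⇒x∉⁅y⁆ z≢x , x≢y⇒x∉⁅y⁆ z≢y ] (x∈p∪q⁻ ⁅ x ⁆ ⁅ y ⁆ z∈)

module _ {R : TransitFn n} (transit : IsTransit R) where
  open IsTransit transit

  ∈-swap : ∀ {a} u v → a ∈ R u v → a ∈ R v u
  ∈-swap {a} u v = subst (a ∈_) (symmetric u v)

  extensiveʳ : ∀ u v → v ∈ R u v
  extensiveʳ u v = ∈-swap v u (extensive v u)

  nested⇒endpoint∈ : ∀ w a b → R w a ⊆ R w b ⊎ R w b ⊆ R w a → a ∈ R w b ⊎ b ∈ R w a
  nested⇒endpoint∈ w a b (inj₁ Rwa⊆Rwb) = inj₁ (Rwa⊆Rwb (extensiveʳ w a))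
  nested⇒endpoint∈ w a b (inj₂ Rwb⊆Rwa) = inj₂ (Rwb⊆Rwa (extensiveʳ w b))

  W-at-centre : ∀ x y z {w} → w ∈ triple x y z →
                (∀ u v → u ∈ triple x y z → v ∈ triple x y z → R w u ⊆ R w v ⊎ R w v ⊆ R w u) →
                z ∈ R x y ⊎ y ∈ R x z ⊎ x ∈ R y z
  W-at-centre x y z w∈ nested with ∈triple⁻ w∈
  ... | inj₁ refl =
    [ (λ y∈Rxz → inj₂ (inj₁ y∈Rxz)) , inj₁ ]
      (nested⇒endpoint∈ x y z (nested y z y∈triple z∈triple))
  ... | inj₂ (inj₁ refl) =
    [ (λ x∈Ryz → inj₂ (inj₂ x∈Ryz)) , (λ z∈Ryx → inj₁ (∈-swap y x z∈Ryx)) ]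
      (nested⇒endpoint∈ y x z (nested x z x∈triple z∈triple))
  ... | inj₂ (inj₂ refl) =
    [ (λ x∈Rzy → inj₂ (inj₂ (∈-swap z y x∈Rzy))) , (λ y∈Rzx → inj₂ (inj₁ (∈-swap z x y∈Rzx))) ]
      (nested⇒endpoint∈ z x y (nested x y x∈triple y∈triple))

mainTheorem15 : (n : ℕ) (R : TransitFn (suc n)) → IsTransit R → Monotone R →
                AxiomTB R → AxiomW R
mainTheorem15 n R transit _ tb x y z with y ≟ x | z ≟ x | z ≟ y
... | yes refl | _        | _        = inj₂ (inj₁ (IsTransit.extensive transit x z))
... | no _     | yes refl | _        = inj₂ (inj₂ (extensiveʳ transit y x))
... | no _     | no _     | yes refl = inj₂ (inj₁ (extensiveʳ transit x y))
... | no y≢x   | no z≢x   | no z≢y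
  with tb (triple x y z) (3≤∣triple∣ y≢x z≢x z≢y)
... | w , w∈ , nested = W-at-centre transit x y z w∈ nested
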